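{- Let $f,g,h$ be integers with $2<f=g<h$. There exists a connected graph $G$ on $2h-f+1$ vertices with $\chi(G)=f$, $\Gamma(G)=g$ and $\psi(G)=h$; i.e., $n(f,g,h)\le 2h-f+1$.
   Context: A complete $k$-coloring of a graph is a proper coloring with exactly $k$ colors in which any two color classes are joined by at least one edge; $\psi$ (achromatic number) is the maximum such $k$, $\chi$ is the chromatic number. A Grundy coloring is a proper coloring $\varphi:V\to\{1,\dots,k\}$ in which every vertex $v$ has a neighbor of color $i$ for every $1\le i<\varphi(v)$; the Grundy number $\Gamma$ is the maximum $k$ for which such a coloring exists. $n(f,g,h)$ is the minimum number of vertices of a connected graph with $\chi=f$, $\Gamma=g$, $\psi=h$. -}

module Defs where

open import Level using (0ℓ)
open import Data.Nat using (ℕ; _≤_; _<_)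
open import Data.Fin using (Fin) renaming (_<_ to _<ᶠ_)
open import Data.Product using (Σ; ∃; ∃-syntax; _×_)
open import Relation.Nullary using (¬_)
open import Relation.Binary.PropositionalEquality using (_≡_; _≢_)
open import Relation.Binary.Construct.Closure.ReflexiveTransitive using (Star)

record Graph (n : ℕ) : Set₁ where
  field
    Adj       : Fin n → Fin n → Set
    sym       : ∀ {u v} → Adj u v → Adj v u
    irrefl    : ∀ {u} → ¬ Adj u u
open Graph public

Connected : ∀ {n} → Graph n → Set
Connected {n} G = ∀ (u v : Fin n) → Star (Adj G) u v

-- A coloring with colors Fin k (colors 1..k in the paper correspond to 0..k-1).
Coloring : ℕ → ℕ → Set
Coloring n k = Fin n → Fin k

Proper : ∀ {n k} → Graph n → Coloring n k → Set
Proper G c = ∀ {u v} → Adj G u v → c u ≢ c v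

Surjective : ∀ {n k} → Coloring n k → Set
Surjective {n} {k} c = ∀ (i : Fin k) → ∃[ v ] c v ≡ i

ProperKColoring : ∀ {n} → Graph n → (k : ℕ) → Coloring n k → Set
ProperKColoring G k c = Proper G c × Surjective c

CompleteColoring : ∀ {n} → Graph n → (k : ℕ) → Coloring n k → Set
CompleteColoring {n} G k c =
  ProperKColoring G k c ×
  (∀ (i j : Fin k) → i ≢ j → ∃[ u ] ∃[ v ] (Adj G u v × c u ≡ i × c v ≡ j))

GrundyColoring : ∀ {n} → Graph n → (k : ℕ) → Coloring n k → Set
GrundyColoring {n} G k c =
  ProperKColoring G k c ×
  (∀ (v : Fin n) (i : Fin k) → i <ᶠ c v → ∃[ u ] (Adj G v u × c u ≡ i))

ChromaticNumber : ∀ {n} → Graph n → ℕ → Set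
ChromaticNumber {n} G f =
  (∃[ c ] Proper {n} {f} G c) ×
  (∀ (k : ℕ) (c : Coloring n k) → Proper G c → f ≤ k)

GrundyNumber : ∀ {n} → Graph n → ℕ → Set
GrundyNumber {n} G g =
  (∃[ c ] GrundyColoring G g c) ×
  (∀ (k : ℕ) (c : Coloring n k) → GrundyColoring G k c → k ≤ g)

AchromaticNumber : ∀ {n} → Graph n → ℕ → Set
AchromaticNumber {n} G h =
  (∃[ c ] CompleteColoring G h c) ×
  (∀ (k : ℕ) (c : Coloring n k) → CompleteColoring G k c → k ≤ h)

module Submission where

-- With a = f − 2 and m = h − f ≥ 1 it consists of a clique
-- A of size a, two vertices T, W joined to each other and to A, vertices
-- X₀ … X_{m−1} joined to A, and vertices Y₀ … Y_m joined to T, with X_i ~ Y_j iff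
-- i < j.
--
-- For the construction
-- we exhibit an f-colour Grundy labelling (giving χ ≤ f ≤ Γ), the clique A ∪ {T, W}
-- (χ ≥ f), a complete h-labelling (ψ ≥ h), and show via the counting lemma that
-- every Grundy labelling uses fewer than f labels (Γ ≤ f). Since N + f = 2h + 1,
-- the achromatic bound gives ψ ≤ h.

open import Defs hiding (sym)
open import Data.Nat using (ℕ; zero; suc; _+_; _*_; _∸_; _≤_; _<_; z≤n; s≤s; z<s)
open import Data.Nat.Properties
open import Data.Nat.Tactic.RingSolver using (solve-∀)
open import Data.Fin using (Fin; zero; suc; toℕ; fromℕ<; splitAt; join; punchIn; punchOut)
open import Data.Fin.Properties
  using (toℕ-injective; toℕ-fromℕ<; toℕ<n; injective⇒≤; any?; splitAt-join; join-splitAt; punchIn-punchOut; +↔⊎; 1↔⊤)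
  renaming (_≟_ to _≟ᶠ_)
open import Data.Vec.Functional using (_∷_)
open import Data.Product using (Σ; ∃-syntax; _×_; _,_; proj₁; proj₂)
open import Data.Sum using (_⊎_; inj₁; inj₂; [_,_]′)
open import Data.Sum.Function.Propositional using (_⊎-↔_)
open import Data.Sum.Properties using (inj₁-injective; inj₂-injective)
open import Data.Unit using (⊤; tt)
open import Data.Empty using (⊥; ⊥-elim)
open import Function using (_∘_; case_of_)
open import Function.Bundles using (_↔_; Inverse)
open import Function.Properties.Inverse using (↔-refl; ↔-trans)
open import Relation.Nullary using (¬_; Dec; yes; no; ¬?)
open import Relation.Nullary.Decidable using (decidable-stable; _×-dec_)
open import Relation.Binary using (tri<; tri≈; tri>)
open import Relation.Binary.PropositionalEquality
  using (_≡_; _≢_; refl; sym; trans; cong; subst; subst₂; module ≡-Reasoning)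
open import Relation.Binary.Construct.Closure.ReflexiveTransitive using (Star; ε; _◅_; _◅◅_; gmap; reverse)

Attained : ∀ {n} → (Fin n → ℕ) → ℕ → Set
Attained g j = ∃[ i ] g i ≡ j

Gap : ∀ {n} → (Fin n → ℕ) → ℕ → Set
Gap g j = ¬ Attained g j

attained? : ∀ {n} (g : Fin n → ℕ) j → Dec (Attained g j)
attained? g j = any? (λ i → g i ≟ j)

all-attained-bound : ∀ {n} (g : Fin n → ℕ) K → (∀ j → j < K → Attained g j) → K ≤ n
all-attained-bound {n} g K attained = injective⇒≤ {f = witness} witness-injective
  where
  witness : Fin K → Fin n
  witness j = proj₁ (attained (toℕ j) (toℕ<n j))
  witness-injective : ∀ {j j′} → witness j ≡ witness j′ → j ≡ j′
  witness-injective {j} {j′} eq = toℕ-injective (begin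
    toℕ j                 ≡⟨ proj₂ (attained (toℕ j) (toℕ<n j)) ⟨
    g (witness j)         ≡⟨ cong g eq ⟩
    g (witness j′)        ≡⟨ proj₂ (attained (toℕ j′) (toℕ<n j′)) ⟩
    toℕ j′                ∎)
    where open ≡-Reasoning

LeastGap : ∀ {n} → (Fin n → ℕ) → ℕ → ℕ → Set
LeastGap g K e = e < K × Gap g e × (∀ j → j < e → Attained g j)

least-gap : ∀ {n} (g : Fin n → ℕ) K → (∀ j → j < K → Attained g j) ⊎ ∃[ e ] LeastGap g K e
least-gap g zero = inj₁ (λ _ ())
least-gap g (suc K) with least-gap g K
... | inj₂ (e , e<K , gap , below) = inj₂ (e , m<n⇒m<1+n e<K , gap , below)
... | inj₁ below with attained? g K
...   | yes att = inj₁ λ j j<1+K → [ below j , (λ { refl → att }) ]′ (m<1+n⇒m<n∨m≡n j<1+K)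
...   | no gap  = inj₂ (K , ≤-refl , gap , below)

fill-least-gap : ∀ {n} {g : Fin n → ℕ} {K e} → LeastGap g K e →
  ∀ j → Gap (e ∷ g) j → e < j × Gap g j
fill-least-gap {g = g} {e = e} (_ , _ , below) j gap′ =
  ≰⇒> (gap′ ∘ attained-up-to-e) , λ { (i , eq) → gap′ (suc i , eq) }
  where
  attained-up-to-e : j ≤ e → Attained (e ∷ g) j
  attained-up-to-e j≤e with m≤n⇒m<n∨m≡n j≤e
  ... | inj₁ j<e  = let (i , eq) = below j j<e in suc i , eq
  ... | inj₂ refl = zero , refl

one-gap-bound : ∀ {n} (g : Fin n → ℕ) K →
  (∀ α β → α < β → β < K → Gap g α → Gap g β → ⊥) → K ≤ suc n
one-gap-bound g K no-two with least-gap g K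
... | inj₁ none = m≤n⇒m≤1+n (all-attained-bound g K none)
... | inj₂ (e , least@(_ , gapₑ , _)) = all-attained-bound (e ∷ g) K λ j j<K →
  decidable-stable (attained? (e ∷ g) j) λ gap′ →
    let (e<j , gapⱼ) = fill-least-gap least j gap′ in no-two e j e<j j<K gapₑ gapⱼ

two-gap-bound : ∀ {n} (g : Fin n → ℕ) K →
  (∀ α β γ → α < β → β < γ → γ < K → Gap g α → Gap g β → Gap g γ → ⊥) → K ≤ suc (suc n)
two-gap-bound g K no-three with least-gap g K
... | inj₁ none = m≤n⇒m≤1+n (m≤n⇒m≤1+n (all-attained-bound g K none))
... | inj₂ (e , least@(_ , gapₑ , _)) = one-gap-bound (e ∷ g) K λ α β α<β β<K gap′α gap′β →
  let (e<α , gapα) = fill-least-gap least α gap′α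
      (_   , gapβ) = fill-least-gap least β gap′β
  in no-three e α β e<α α<β β<K gapₑ gapα gapβ

⊎-injection-bound : ∀ {k l n m} (F : Fin k ⊎ Fin l → Fin n ⊎ Fin m) →
  (∀ {x y} → F x ≡ F y → x ≡ y) → k + l ≤ n + m
⊎-injection-bound {k} {l} {n} {m} F F-injective =
  injective⇒≤ {f = join n m ∘ F ∘ splitAt k} λ {x} {y} eq → begin
    x                      ≡⟨ join-splitAt k l x ⟨
    join k l (splitAt k x) ≡⟨ cong (join k l) (F-injective (begin
      F (splitAt k x)                           ≡⟨ splitAt-join n m _ ⟨
      splitAt n (join n m (F (splitAt k x)))    ≡⟨ cong (splitAt n) eq ⟩
      splitAt n (join n m (F (splitAt k y)))    ≡⟨ splitAt-join n m _ ⟩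
      F (splitAt k y)                           ∎)) ⟩
    join k l (splitAt k y) ≡⟨ join-splitAt k l y ⟩
    y                      ∎
  where open ≡-Reasoning

clique-bound : ∀ {n f} (G : Graph n) (κ : Fin f → Fin n) →
  (∀ {i j} → i ≢ j → Adj G (κ i) (κ j)) → ∀ k (c : Coloring n k) → Proper G c → f ≤ k
clique-bound G κ clique _ c proper = injective⇒≤ {f = c ∘ κ} λ {i} {j} eq →
  decidable-stable (i ≟ᶠ j) λ i≢j → proper (clique i≢j) eq

-- Achromatic bound 2ψ ≤ n + χ: for a proper f-colouring d and a complete
-- k-colouring c, send the classes of c injectively into vertices ⊎ colours of d:
-- the first copy of class i goes to a representative, the second copy to another
-- vertex of the class if there is one, and otherwise to the d-colour of its single
-- vertex. Singleton classes are pairwise adjacent (c is complete), so d separates them.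
module _ {n f k : ℕ} (G : Graph n) {d : Coloring n f} (d-proper : Proper G d)
         {c : Coloring n k} (c-complete : CompleteColoring G k c) where

  private
    representative : Fin k → Fin n
    representative i = proj₁ (proj₂ (proj₁ c-complete) i)

    representative-colour : ∀ i → c (representative i) ≡ i
    representative-colour i = proj₂ (proj₂ (proj₁ c-complete) i)

    NonSingleton : Fin k → Set
    NonSingleton i = ∃[ v ] (v ≢ representative i × c v ≡ i)

    non-singleton? : ∀ i → Dec (NonSingleton i)
    non-singleton? i = any? (λ v → ¬? (v ≟ᶠ representative i) ×-dec (c v ≟ᶠ i))

    singleton : ∀ {i} → ¬ NonSingleton i → ∀ {v} → c v ≡ i → v ≡ representative i
    singleton {i} ¬ns {v} cv≡i = decidable-stable (v ≟ᶠ representative i) λ v≢rep → ¬ns (v , v≢rep , cv≡i)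

    second : ∀ i → Dec (NonSingleton i) → Fin n ⊎ Fin f
    second i (yes (v , _)) = inj₁ v
    second i (no _)        = inj₂ (d (representative i))

    class-image : Fin k ⊎ Fin k → Fin n ⊎ Fin f
    class-image (inj₁ i) = inj₁ (representative i)
    class-image (inj₂ i) = second i (non-singleton? i)

    first≢second : ∀ i j (dec : Dec (NonSingleton j)) → inj₁ (representative i) ≢ second j dec
    first≢second i j (yes (v , v≢rep , cv≡j)) refl = v≢rep (cong representative
      (trans (sym (representative-colour i)) cv≡j))
    first≢second i j (no _) ()

    second-injective : ∀ i j (deci : Dec (NonSingleton i)) (decj : Dec (NonSingleton j)) →
      second i deci ≡ second j decj → i ≡ j
    second-injective i j (yes (_ , _ , cv≡i)) (yes (_ , _ , cv≡j)) refl = trans (sym cv≡i) cv≡j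
    second-injective i j (yes _) (no _) ()
    second-injective i j (no _) (yes _) ()
    second-injective i j (no ¬nsi) (no ¬nsj) eq = decidable-stable (i ≟ᶠ j) λ i≢j →
      let (u , v , uv , cu≡i , cv≡j) = proj₂ c-complete i j i≢j
      in d-proper (subst₂ (Adj G) (singleton ¬nsi cu≡i) (singleton ¬nsj cv≡j) uv)
                  (inj₂-injective eq)

    class-image-injective : ∀ {x y} → class-image x ≡ class-image y → x ≡ y
    class-image-injective {inj₁ i} {inj₁ j} eq = cong inj₁ (begin
      i                       ≡⟨ representative-colour i ⟨
      c (representative i)    ≡⟨ cong c (inj₁-injective eq) ⟩
      c (representative j)    ≡⟨ representative-colour j ⟩
      j                       ∎)
      where open ≡-Reasoning
    class-image-injective {inj₁ i} {inj₂ j} eq = ⊥-elim (first≢second i j _ eq)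
    class-image-injective {inj₂ i} {inj₁ j} eq = ⊥-elim (first≢second j i _ (sym eq))
    class-image-injective {inj₂ i} {inj₂ j} eq = cong inj₂ (second-injective i j _ _ eq)

  complete-colouring-bound : k + k ≤ n + f
  complete-colouring-bound = ⊎-injection-bound class-image class-image-injective

half-bound : ∀ k n → k + k ≤ suc (n + n) → k ≤ n
half-bound k n k+k≤1+2n = ≮⇒≥ λ n<k → 1+n≰n (begin
  suc (suc (n + n)) ≡⟨ cong suc (+-suc n n) ⟨
  suc n + suc n     ≤⟨ +-mono-≤ n<k n<k ⟩
  k + k             ≤⟨ k+k≤1+2n ⟩
  suc (n + n)       ∎)
  where open ≤-Reasoning

-- Graphs presented on a type V in bijection with Fin N. Colourings are described by
-- natural-number labels on V; this module transfers them to colourings of the graph.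
module Presented {V : Set} {N : ℕ} (E : V → V → Set)
                 (E-sym : ∀ {x y} → E x y → E y x) (E-irrefl : ∀ {x} → ¬ E x x)
                 (code : Fin N ↔ V) where

  decode : Fin N → V
  decode = Inverse.to code

  encode : V → Fin N
  encode = Inverse.from code

  decode-encode : ∀ x → decode (encode x) ≡ x
  decode-encode = Inverse.strictlyInverseˡ code

  encode-decode : ∀ u → encode (decode u) ≡ u
  encode-decode = Inverse.strictlyInverseʳ code

  graph : Graph N
  graph = record { Adj = λ u v → E (decode u) (decode v) ; sym = E-sym ; irrefl = E-irrefl }

  adj-encode : ∀ {x y} → E x y → Adj graph (encode x) (encode y)
  adj-encode {x} {y} = subst₂ E (sym (decode-encode x)) (sym (decode-encode y))

  connected-via : (hub : V) → (∀ x → Star E x hub) → Connected graph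
  connected-via hub reach u v = to-hub u ◅◅ reverse (Graph.sym graph) (to-hub v)
    where
    to-hub : ∀ u → Star (Adj graph) u (encode hub)
    to-hub u = subst (λ w → Star (Adj graph) w (encode hub)) (encode-decode u)
                     (gmap encode adj-encode (reach (decode u)))

  ProperLabelling : (V → ℕ) → Set
  ProperLabelling ℓ = ∀ x y → E x y → ℓ x ≢ ℓ y

  GrundyLabelling : (V → ℕ) → Set
  GrundyLabelling ℓ = ProperLabelling ℓ × (∀ x i → i < ℓ x → ∃[ y ] (E x y × ℓ y ≡ i))

  LabelsOnto : (V → ℕ) → ℕ → Set
  LabelsOnto ℓ k = ∀ i → i < k → ∃[ x ] ℓ x ≡ i

  LabelsMeet : (V → ℕ) → ℕ → Set
  LabelsMeet ℓ k = ∀ i j → i < k → j < k → i ≢ j → ∃[ x ] ∃[ y ] (E x y × ℓ x ≡ i × ℓ y ≡ j)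

  module _ (ℓ : V → ℕ) {k : ℕ} (ℓ<k : ∀ x → ℓ x < k) where

    colouring : Coloring N k
    colouring u = fromℕ< (ℓ<k (decode u))

    colouring-encode : ∀ x → toℕ (colouring (encode x)) ≡ ℓ x
    colouring-encode x = trans (toℕ-fromℕ< (ℓ<k _)) (cong ℓ (decode-encode x))

    colour-at : ∀ x (i : Fin k) → ℓ x ≡ toℕ i → colouring (encode x) ≡ i
    colour-at x i eq = toℕ-injective (trans (colouring-encode x) eq)

    colouring-proper : ProperLabelling ℓ → Proper graph colouring
    colouring-proper proper {u} {v} uv eq =
      proper (decode u) (decode v) uv (same-label eq)
      where
      same-label : colouring u ≡ colouring v → ℓ (decode u) ≡ ℓ (decode v)
      same-label eq = trans (sym (toℕ-fromℕ< (ℓ<k _))) (trans (cong toℕ eq) (toℕ-fromℕ< (ℓ<k _)))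

    colouring-surjective : LabelsOnto ℓ k → Surjective colouring
    colouring-surjective onto i =
      let (x , ℓx≡i) = onto (toℕ i) (toℕ<n i) in encode x , colour-at x i ℓx≡i

    colouring-grundy : GrundyLabelling ℓ → LabelsOnto ℓ k → GrundyColoring graph k colouring
    colouring-grundy (proper , sees) onto =
      (colouring-proper proper , colouring-surjective onto) , λ u i i<cu →
        let (y , uy , ℓy≡i) = sees (decode u) (toℕ i) (subst (toℕ i <_) (toℕ-fromℕ< (ℓ<k _)) i<cu)
        in encode y , subst (E (decode u)) (sym (decode-encode y)) uy , colour-at y i ℓy≡i

    colouring-complete : ProperLabelling ℓ → LabelsOnto ℓ k → LabelsMeet ℓ k →
      CompleteColoring graph k colouring
    colouring-complete proper onto meet =
      (colouring-proper proper , colouring-surjective onto) , λ i j i≢j →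
        let (x , y , xy , ℓx≡i , ℓy≡j) = meet (toℕ i) (toℕ j) (toℕ<n i) (toℕ<n j) (i≢j ∘ toℕ-injective)
        in encode x , encode y , adj-encode xy , colour-at x i ℓx≡i , colour-at y j ℓy≡j

  grundy-labelling : ∀ {k} (c : Coloring N k) → GrundyColoring graph k c → GrundyLabelling (toℕ ∘ c ∘ encode)
  grundy-labelling c ((proper , _) , sees) = labels-proper , labels-see
    where
    labels-proper : ProperLabelling (toℕ ∘ c ∘ encode)
    labels-proper x y xy = proper (adj-encode xy) ∘ toℕ-injective
    labels-see : ∀ x i → i < toℕ (c (encode x)) → ∃[ y ] (E x y × toℕ (c (encode y)) ≡ i)
    labels-see x i i<cx =
      let i<k = <-trans i<cx (toℕ<n _)
          (u , xu , cu≡i) = sees (encode x) (fromℕ< i<k) (subst (_< toℕ (c (encode x))) (sym (toℕ-fromℕ< i<k)) i<cx)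
      in decode u , subst (λ z → E z (decode u)) (decode-encode x) xu ,
         trans (cong (toℕ ∘ c) (encode-decode u)) (trans (cong toℕ cu≡i) (toℕ-fromℕ< i<k))

  grundy-bound : ∀ {f} → (∀ ℓ → GrundyLabelling ℓ → ∀ x → ℓ x < f) →
    ∀ k (c : Coloring N k) → GrundyColoring graph k c → k ≤ f
  grundy-bound {f} labels<f k c grundy = ≮⇒≥ λ f<k →
    let (u , cu≡f) = proj₂ (proj₁ grundy) (fromℕ< f<k)
    in <-irrefl (trans (cong toℕ cu≡f) (toℕ-fromℕ< f<k))
                (subst (λ w → toℕ (c w) < f) (encode-decode u)
                       (labels<f _ (grundy-labelling c grundy) (decode u)))

module Construction (b m : ℕ) where

  a : ℕ
  a = suc b

  V : Set
  V = Fin a ⊎ (⊤ ⊎ (⊤ ⊎ (Fin m ⊎ Fin (suc m))))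

  pattern vA i = inj₁ i
  pattern vT   = inj₂ (inj₁ tt)
  pattern vW   = inj₂ (inj₂ (inj₁ tt))
  pattern vX i = inj₂ (inj₂ (inj₂ (inj₁ i)))
  pattern vY j = inj₂ (inj₂ (inj₂ (inj₂ j)))

  N : ℕ
  N = a + (1 + (1 + (m + suc m)))

  code : Fin N ↔ V
  code = ↔-trans +↔⊎ (↔-refl ⊎-↔ ↔-trans +↔⊎ (1↔⊤ ⊎-↔ ↔-trans +↔⊎ (1↔⊤ ⊎-↔ +↔⊎)))

  E : V → V → Set
  E (vA i) (vA j) = i ≢ j
  E (vA _) vT     = ⊤
  E (vA _) vW     = ⊤
  E (vA _) (vX _) = ⊤
  E vT     (vA _) = ⊤
  E vT     vW     = ⊤
  E vT     (vY _) = ⊤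
  E vW     (vA _) = ⊤
  E vW     vT     = ⊤
  E (vX _) (vA _) = ⊤
  E (vX i) (vY j) = toℕ i < toℕ j
  E (vY _) vT     = ⊤
  E (vY j) (vX i) = toℕ i < toℕ j
  E _      _      = ⊥

  E-sym : ∀ {x y} → E x y → E y x
  E-sym {vA i} {vA j} i≢j = i≢j ∘ sym
  E-sym {vA _} {vT}   _   = tt
  E-sym {vA _} {vW}   _   = tt
  E-sym {vA _} {vX _} _   = tt
  E-sym {vT}   {vA _} _   = tt
  E-sym {vT}   {vW}   _   = tt
  E-sym {vT}   {vY _} _   = tt
  E-sym {vW}   {vA _} _   = tt
  E-sym {vW}   {vT}   _   = tt
  E-sym {vX _} {vA _} _   = tt
  E-sym {vX _} {vY _} i<j = i<j
  E-sym {vY _} {vT}   _   = tt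
  E-sym {vY _} {vX _} i<j = i<j

  E-irrefl : ∀ {x} → ¬ E x x
  E-irrefl {vA _} i≢i = i≢i refl
  E-irrefl {vT}   ()
  E-irrefl {vW}   ()
  E-irrefl {vX _} ()
  E-irrefl {vY _} ()

  open Presented E E-sym E-irrefl code public

  connected : Connected graph
  connected = connected-via vT to-T
    where
    to-T : ∀ x → Star E x vT
    to-T (vA _) = tt ◅ ε
    to-T vT     = ε
    to-T vW     = tt ◅ ε
    to-T (vX _) = _◅_ {j = vA zero} tt (tt ◅ ε)
    to-T (vY _) = tt ◅ ε

  f : ℕ
  f = suc (suc a)

  clique : Fin f → V
  clique zero          = vT
  clique (suc zero)    = vW
  clique (suc (suc i)) = vA i

  clique-adjacent : ∀ {i j} → i ≢ j → E (clique i) (clique j)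
  clique-adjacent {zero}        {zero}        0≢0 = 0≢0 refl
  clique-adjacent {zero}        {suc zero}    _   = tt
  clique-adjacent {zero}        {suc (suc _)} _   = tt
  clique-adjacent {suc zero}    {zero}        _   = tt
  clique-adjacent {suc zero}    {suc zero}    1≢1 = 1≢1 refl
  clique-adjacent {suc zero}    {suc (suc _)} _   = tt
  clique-adjacent {suc (suc _)} {zero}        _   = tt
  clique-adjacent {suc (suc _)} {suc zero}    _   = tt
  clique-adjacent {suc (suc _)} {suc (suc _)} i≢j = i≢j ∘ cong {A = Fin a} {B = Fin f} (λ k → suc (suc k))

  grundy-label : V → ℕ
  grundy-label (vA i) = toℕ i
  grundy-label vT     = a
  grundy-label vW     = suc a
  grundy-label (vX _) = a
  grundy-label (vY _) = 0

  a<f : a < f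
  a<f = m<n⇒m<1+n (n<1+n a)

  grundy-label<f : ∀ x → grundy-label x < f
  grundy-label<f (vA i) = <-trans (toℕ<n i) a<f
  grundy-label<f vT     = a<f
  grundy-label<f vW     = n<1+n (suc a)
  grundy-label<f (vX _) = a<f
  grundy-label<f (vY _) = z<s

  grundy-label-grundy : GrundyLabelling grundy-label
  grundy-label-grundy = proper , sees
    where
    proper : ProperLabelling grundy-label
    proper (vA i) (vA j) i≢j eq = i≢j (toℕ-injective eq)
    proper (vA i) vT     _   eq = <⇒≢ (toℕ<n i) eq
    proper (vA i) vW     _   eq = <⇒≢ (m<n⇒m<1+n (toℕ<n i)) eq
    proper (vA i) (vX _) _   eq = <⇒≢ (toℕ<n i) eq
    proper vT     (vA i) _   eq = <⇒≢ (toℕ<n i) (sym eq)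
    proper vT     vW     _   eq = <⇒≢ (n<1+n a) eq
    proper vW     (vA i) _   eq = <⇒≢ (m<n⇒m<1+n (toℕ<n i)) (sym eq)
    proper vW     vT     _   eq = <⇒≢ (n<1+n a) (sym eq)
    proper (vX _) (vA i) _   eq = <⇒≢ (toℕ<n i) (sym eq)
    proper vT     (vY _) _   ()
    proper (vX _) (vY _) _   ()
    proper (vY _) vT     _   ()
    proper (vY _) (vX _) _   ()
    sees : ∀ x i → i < grundy-label x → ∃[ y ] (E x y × grundy-label y ≡ i)
    sees (vA j) i i<j = vA (fromℕ< i<a) , (λ i≡j → <⇒≢ i<j (trans (sym (toℕ-fromℕ< i<a)) (cong toℕ (sym i≡j)))) ,
                        toℕ-fromℕ< i<a
      where i<a = <-trans i<j (toℕ<n j)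
    sees vT     i i<a = vA (fromℕ< i<a) , tt , toℕ-fromℕ< i<a
    sees (vX _) i i<a = vA (fromℕ< i<a) , tt , toℕ-fromℕ< i<a
    sees vW     i i<1+a with m<1+n⇒m<n∨m≡n i<1+a
    ... | inj₁ i<a  = vA (fromℕ< i<a) , tt , toℕ-fromℕ< i<a
    ... | inj₂ refl = vT , tt , refl

  grundy-label-onto : LabelsOnto grundy-label f
  grundy-label-onto i i<f with m<1+n⇒m<n∨m≡n i<f
  ... | inj₂ refl = vW , refl
  ... | inj₁ i<1+a with m<1+n⇒m<n∨m≡n i<1+a
  ...   | inj₁ i<a  = vA (fromℕ< i<a) , toℕ-fromℕ< i<a
  ...   | inj₂ refl = vT , refl

  h : ℕ
  h = suc a + suc m

  a<upper : ∀ q → a < suc a + q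
  a<upper q = m≤m+n (suc a) q

  complete-label : V → ℕ
  complete-label (vA i) = toℕ i
  complete-label vT     = a
  complete-label vW     = suc a + m
  complete-label (vX i) = suc a + toℕ i
  complete-label (vY j) = suc a + toℕ j

  complete-label<h : ∀ x → complete-label x < h
  complete-label<h (vA i) = <-trans (toℕ<n i) (a<upper (suc m))
  complete-label<h vT     = a<upper (suc m)
  complete-label<h vW     = +-monoʳ-< (suc a) (n<1+n m)
  complete-label<h (vX i) = +-monoʳ-< (suc a) (<-trans (toℕ<n i) (n<1+n m))
  complete-label<h (vY j) = +-monoʳ-< (suc a) (toℕ<n j)

  complete-label-proper : ProperLabelling complete-label
  complete-label-proper (vA i) (vA j) i≢j eq = i≢j (toℕ-injective eq)
  complete-label-proper (vA i) vT     _   eq = <⇒≢ (toℕ<n i) eq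
  complete-label-proper (vA i) vW     _   eq = <⇒≢ (<-trans (toℕ<n i) (a<upper m)) eq
  complete-label-proper (vA i) (vX j) _   eq = <⇒≢ (<-trans (toℕ<n i) (a<upper (toℕ j))) eq
  complete-label-proper vT     (vA i) _   eq = <⇒≢ (toℕ<n i) (sym eq)
  complete-label-proper vT     vW     _   eq = <⇒≢ (a<upper m) eq
  complete-label-proper vT     (vY j) _   eq = <⇒≢ (a<upper (toℕ j)) eq
  complete-label-proper vW     (vA i) _   eq = <⇒≢ (<-trans (toℕ<n i) (a<upper m)) (sym eq)
  complete-label-proper vW     vT     _   eq = <⇒≢ (a<upper m) (sym eq)
  complete-label-proper (vX j) (vA i) _   eq = <⇒≢ (<-trans (toℕ<n i) (a<upper (toℕ j))) (sym eq)
  complete-label-proper (vX i) (vY j) i<j eq = <⇒≢ i<j (+-cancelˡ-≡ (suc a) _ _ eq)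
  complete-label-proper (vY j) vT     _   eq = <⇒≢ (a<upper (toℕ j)) (sym eq)
  complete-label-proper (vY j) (vX i) i<j eq = <⇒≢ i<j (+-cancelˡ-≡ (suc a) _ _ (sym eq))

  data LabelView : ℕ → Set where
    low  : (i : Fin a) → LabelView (toℕ i)
    mid  : LabelView a
    high : ∀ q → q ≤ m → LabelView (suc a + q)

  label-view : ∀ j → j < h → LabelView j
  label-view j j<h with <-cmp j a
  ... | tri< j<a _ _  = subst LabelView (toℕ-fromℕ< j<a) (low (fromℕ< j<a))
  ... | tri≈ _ refl _ = mid
  ... | tri> _ _ a<j with m≤n⇒∃[o]m+o≡n a<j
  ...   | q , refl = high q (≤-pred (+-cancelˡ-< (suc a) q (suc m) j<h))

  Y-at : ∀ q → q ≤ m → V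
  Y-at q q≤m = vY (fromℕ< (s≤s q≤m))

  Y-at-label : ∀ q (q≤m : q ≤ m) → complete-label (Y-at q q≤m) ≡ suc a + q
  Y-at-label q q≤m = cong (suc a +_) (toℕ-fromℕ< (s≤s q≤m))

  XW-at : ∀ q → q ≤ m → ∃[ y ] ((∀ i → E (vA i) y) × complete-label y ≡ suc a + q)
  XW-at q q≤m with m≤n⇒m<n∨m≡n q≤m
  ... | inj₁ q<m  = vX (fromℕ< q<m) , (λ _ → tt) , cong (suc a +_) (toℕ-fromℕ< q<m)
  ... | inj₂ refl = vW , (λ _ → tt) , refl

  complete-label-onto : LabelsOnto complete-label h
  complete-label-onto j j<h with label-view j j<h
  ... | low i      = vA i , refl
  ... | mid        = vT , refl
  ... | high q q≤m = Y-at q q≤m , Y-at-label q q≤m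

  meet-ordered : ∀ {i j} → LabelView i → LabelView j → i < j →
    ∃[ x ] ∃[ y ] (E x y × complete-label x ≡ i × complete-label y ≡ j)
  meet-ordered (low i) (low j) i<j = vA i , vA j , (λ i≡j → <⇒≢ i<j (cong toℕ i≡j)) , refl , refl
  meet-ordered (low i) mid     _   = vA i , vT , tt , refl , refl
  meet-ordered (low i) (high q q≤m) _ =
    let (y , A-adjacent , eq) = XW-at q q≤m in vA i , y , A-adjacent i , refl , eq
  meet-ordered mid (high q q≤m) _ = vT , Y-at q q≤m , tt , refl , Y-at-label q q≤m
  meet-ordered (high p _) (high q q≤m) i<j =
    vX (fromℕ< p<m) , Y-at q q≤m ,
    subst₂ _<_ (sym (toℕ-fromℕ< p<m)) (sym (toℕ-fromℕ< (s≤s q≤m))) p<q ,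
    cong (suc a +_) (toℕ-fromℕ< p<m) , Y-at-label q q≤m
    where
    p<q = +-cancelˡ-< (suc a) p q i<j
    p<m = <-≤-trans p<q q≤m
  meet-ordered mid        (low j)  i<j = ⊥-elim (<-asym i<j (toℕ<n j))
  meet-ordered mid        mid      i<j = ⊥-elim (<-irrefl refl i<j)
  meet-ordered (high p _) (low j)  i<j = ⊥-elim (<-asym i<j (<-trans (toℕ<n j) (a<upper p)))
  meet-ordered (high p _) mid      i<j = ⊥-elim (<-asym i<j (a<upper p))

  complete-label-meet : LabelsMeet complete-label h
  complete-label-meet i j i<h j<h i≢j with <-cmp i j
  ... | tri< i<j _ _ = meet-ordered (label-view i i<h) (label-view j j<h) i<j
  ... | tri≈ _ i≡j _ = ⊥-elim (i≢j i≡j)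
  ... | tri> _ _ j<i =
    let (x , y , xy , ℓx≡j , ℓy≡i) = meet-ordered (label-view j j<h) (label-view i i<h) j<i
    in y , x , E-sym xy , ℓy≡i , ℓx≡j

  -- A gap is a label missing on A.
  -- The key facts: below T, W and each X there is at most one gap, so these labels
  -- are ≤ a + 1; a clique vertex sees at most two gaps of the other a − 1 clique
  -- vertices, so its label is ≤ a + 1; and Y-labels are ≤ 2.
  module GrundyBound (ℓ : V → ℕ) (grundy : GrundyLabelling ℓ) where

    private
      proper = proj₁ grundy
      sees   = proj₂ grundy

    clique-label : Fin a → ℕ
    clique-label i = ℓ (vA i)

    -- The neighbours T, X_v of a Y-vertex are adjacent to all of A.
    Y≤A : ∀ s i → ℓ (vY s) ≤ ℓ (vA i)
    Y≤A s i = ≮⇒≥ λ A<Y → case sees (vY s) (ℓ (vA i)) A<Y of λ where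
      (vT   , _ , eq) → proper (vA i) vT     tt (sym eq)
      (vX v , _ , eq) → proper (vA i) (vX v) tt (sym eq)
      (vA _ , () , _)
      (vW   , () , _)
      (vY _ , () , _)

    -- The neighbours of an X-vertex (A and Y) are adjacent to T.
    X≤T : ∀ v → ℓ (vX v) ≤ ℓ vT
    X≤T v = ≮⇒≥ λ T<X → case sees (vX v) (ℓ vT) T<X of λ where
      (vA i , _ , eq) → proper (vA i) vT tt eq
      (vY s , _ , eq) → proper (vY s) vT tt eq
      (vT   , () , _)
      (vW   , () , _)
      (vX _ , () , _)

    -- W sees only A and T, so the only possible gap below W is ℓ T.
    gap-below-W : ∀ α → α < ℓ vW → Gap clique-label α → ℓ vT ≡ α
    gap-below-W α α<W gap with sees vW α α<W
    ... | vA i , _ , eq = ⊥-elim (gap (i , eq))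
    ... | vT   , _ , eq = eq
    ... | vW   , () , _
    ... | vX _ , () , _
    ... | vY _ , () , _

    no-gap-below-W-and-T : ∀ α → α < ℓ vW → α < ℓ vT → Gap clique-label α → ⊥
    no-gap-below-W-and-T α α<W α<T gap = <⇒≢ α<T (sym (gap-below-W α α<W gap))

    equal-XY : ∀ v s → ℓ (vX v) ≡ ℓ (vY s) → toℕ s ≤ toℕ v
    equal-XY v s eq = ≮⇒≥ λ v<s → proper (vX v) (vY s) v<s eq

    -- If X_v and Y_s share a label above a gap α < ℓ T, then X_v must see α at
    -- some Y_r (v < r) and Y_s at some X_u (u < s); equal-XY then gives
    -- r ≤ u < s ≤ v < r.
    XY-above-gap : ∀ α v s → Gap clique-label α → α < ℓ vT → α < ℓ (vX v) →
      ℓ (vX v) ≡ ℓ (vY s) → ⊥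
    XY-above-gap α v s gap α<T α<X X≡Y with sees (vX v) α α<X
    ... | vA i , _ , eq = gap (i , eq)
    ... | vT   , () , _
    ... | vW   , () , _
    ... | vX _ , () , _
    ... | vY r , v<r , Yr≡α with sees (vY s) α (subst (α <_) X≡Y α<X)
    ...   | vT   , _ , T≡α  = <⇒≢ α<T (sym T≡α)
    ...   | vA _ , () , _
    ...   | vW   , () , _
    ...   | vY _ , () , _
    ...   | vX u , u<s , Xu≡α = <-irrefl refl (begin-strict
      toℕ u  <⟨ u<s ⟩
      toℕ s  ≤⟨ equal-XY v s X≡Y ⟩
      toℕ v  <⟨ v<r ⟩
      toℕ r  ≤⟨ equal-XY u r (trans Xu≡α (sym Yr≡α)) ⟩
      toℕ u  ∎)
      where open ≤-Reasoning

    -- Below T there are no two gaps α < β: T would see β at W (then α = ℓ T),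
    -- or at some Y_s; in the latter case the clique vertex A₀ sees β at some X_v,
    -- contradicting XY-above-gap.
    T-one-gap : ∀ α β → α < β → β < ℓ vT → Gap clique-label α → Gap clique-label β → ⊥
    T-one-gap α β α<β β<T gapα gapβ with sees vT β β<T
    ... | vA i , _ , eq = gapβ (i , eq)
    ... | vW   , _ , eq = no-gap-below-W-and-T α (subst (α <_) (sym eq) α<β) α<T gapα
      where α<T = <-trans α<β β<T
    ... | vT   , () , _
    ... | vX _ , () , _
    ... | vY s , _ , Ys≡β with sees (vA zero) β β<A₀
      where β<A₀ = ≤∧≢⇒< (subst (_≤ ℓ (vA zero)) Ys≡β (Y≤A s zero)) (λ β≡A₀ → gapβ (zero , sym β≡A₀))
    ...   | vA j , _ , eq = gapβ (j , eq)
    ...   | vT   , _ , eq = <⇒≢ β<T (sym eq)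
    ...   | vW   , _ , eq = no-gap-below-W-and-T α (subst (α <_) (sym eq) α<β) (<-trans α<β β<T) gapα
    ...   | vY _ , () , _
    ...   | vX v , _ , Xv≡β =
      XY-above-gap α v s gapα (<-trans α<β β<T) (subst (α <_) (sym Xv≡β) α<β) (trans Xv≡β (sym Ys≡β))

    X-one-gap : ∀ v α β → α < β → β < ℓ (vX v) → Gap clique-label α → Gap clique-label β → ⊥
    X-one-gap v α β α<β β<X = T-one-gap α β α<β (<-≤-trans β<X (X≤T v))

    W-one-gap : ∀ α β → α < β → β < ℓ vW → Gap clique-label α → Gap clique-label β → ⊥
    W-one-gap α β α<β β<W gapα gapβ =
      <⇒≢ α<β (trans (sym (gap-below-W α (<-trans α<β β<W) gapα)) (gap-below-W β β<W gapβ))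

    -- Clique labels are at least every Y-label, so labels below a Y-label are gaps.
    gap-below-Y : ∀ s j → j < ℓ (vY s) → Gap clique-label j
    gap-below-Y s j j<Y (i , Ai≡j) = <⇒≱ j<Y (subst (ℓ (vY s) ≤_) Ai≡j (Y≤A s i))

    -- A Y-label > 2 would leave gaps 0 and 1 below the label 2 seen at T or an X.
    Y≤2 : ∀ s → ℓ (vY s) ≤ 2
    Y≤2 s = ≮⇒≥ λ 2<Y → sees-2 2<Y (sees (vY s) 2 2<Y)
      where
      gap₀ : 2 < ℓ (vY s) → Gap clique-label 0
      gap₀ 2<Y = gap-below-Y s 0 (<-trans z<s (<-trans (n<1+n 1) 2<Y))
      gap₁ : 2 < ℓ (vY s) → Gap clique-label 1
      gap₁ 2<Y = gap-below-Y s 1 (<-trans (n<1+n 1) 2<Y)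
      sees-2 : 2 < ℓ (vY s) → ∃[ y ] (E (vY s) y × ℓ y ≡ 2) → ⊥
      sees-2 2<Y (vT   , _ , eq) = T-one-gap 0 1 z<s (subst (1 <_) (sym eq) ≤-refl) (gap₀ 2<Y) (gap₁ 2<Y)
      sees-2 2<Y (vX v , _ , eq) = X-one-gap v 0 1 z<s (subst (1 <_) (sym eq) ≤-refl) (gap₀ 2<Y) (gap₁ 2<Y)
      sees-2 _ (vA _ , () , _)
      sees-2 _ (vW   , () , _)
      sees-2 _ (vY _ , () , _)

    -- The clique vertex A_i sees its label set at the other clique vertices, except
    -- for at most two gaps: a third gap γ would be seen at T, W or an X, all of
    -- which have at most one gap below them.
    A-bound : ∀ i → ℓ (vA i) ≤ suc a
    A-bound i = two-gap-bound others (ℓ (vA i)) three-gaps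
      where
      others : Fin b → ℕ
      others j = ℓ (vA (punchIn i j))
      gap-of-others : ∀ α → α < ℓ (vA i) → Gap others α → Gap clique-label α
      gap-of-others α α<A gap′ (j , Aj≡α) with i ≟ᶠ j
      ... | yes refl = <⇒≢ α<A (sym Aj≡α)
      ... | no i≢j   = gap′ (punchOut i≢j , trans (cong (ℓ ∘ vA) (punchIn-punchOut i≢j)) Aj≡α)
      three-gaps : ∀ α β γ → α < β → β < γ → γ < ℓ (vA i) →
        Gap others α → Gap others β → Gap others γ → ⊥
      three-gaps α β γ α<β β<γ γ<A gapα gapβ gapγ = sees-γ (sees (vA i) γ γ<A)
        where
        gapα′ = gap-of-others α (<-trans α<β (<-trans β<γ γ<A)) gapα
        gapβ′ = gap-of-others β (<-trans β<γ γ<A) gapβ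
        sees-γ : ∃[ y ] (E (vA i) y × ℓ y ≡ γ) → ⊥
        sees-γ (vA j , _ , eq) = gap-of-others γ γ<A gapγ (j , eq)
        sees-γ (vT   , _ , eq) = T-one-gap α β α<β (subst (β <_) (sym eq) β<γ) gapα′ gapβ′
        sees-γ (vW   , _ , eq) = W-one-gap α β α<β (subst (β <_) (sym eq) β<γ) gapα′ gapβ′
        sees-γ (vX v , _ , eq) = X-one-gap v α β α<β (subst (β <_) (sym eq) β<γ) gapα′ gapβ′
        sees-γ (vY _ , () , _)

    label<f : ∀ x → ℓ x < f
    label<f (vA i) = s≤s (A-bound i)
    label<f vT     = s≤s (one-gap-bound clique-label (ℓ vT) T-one-gap)
    label<f vW     = s≤s (one-gap-bound clique-label (ℓ vW) W-one-gap)
    label<f (vX v) = s≤s (one-gap-bound clique-label (ℓ (vX v)) (X-one-gap v))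
    label<f (vY s) = s≤s (≤-trans (Y≤2 s) (s≤s (s≤s z≤n)))

  chromatic-colouring : Σ (Coloring N f) (Proper graph)
  chromatic-colouring = colouring grundy-label grundy-label<f ,
                        λ {u} {v} → colouring-proper grundy-label grundy-label<f (proj₁ grundy-label-grundy) {u} {v}

  chromatic : ChromaticNumber graph f
  chromatic = chromatic-colouring ,
    clique-bound graph (encode ∘ clique) (λ {i} {j} i≢j → adj-encode {clique i} {clique j} (clique-adjacent i≢j))

  grundy-number : GrundyNumber graph f
  grundy-number = (colouring grundy-label grundy-label<f ,
                   colouring-grundy grundy-label grundy-label<f grundy-label-grundy grundy-label-onto)
                , grundy-bound (λ ℓ grundy → GrundyBound.label<f ℓ grundy)

  -- N + f = 2h + 1, so the achromatic bound 2k ≤ N + f gives k ≤ h.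
  N+f≡1+2h : N + f ≡ suc (h + h)
  N+f≡1+2h = arithmetic b m
    where
    arithmetic : ∀ b m → suc b + (1 + (1 + (m + suc m))) + suc (suc (suc b)) ≡
                         suc (suc (suc b) + suc m + (suc (suc b) + suc m))
    arithmetic = solve-∀

  achromatic : AchromaticNumber graph h
  achromatic = (colouring complete-label complete-label<h ,
                colouring-complete complete-label complete-label<h
                  complete-label-proper complete-label-onto complete-label-meet)
             , λ k c complete → half-bound k h (subst (k + k ≤_) N+f≡1+2h
                  (complete-colouring-bound graph {d = proj₁ chromatic-colouring} (λ {u} {v} → proj₂ chromatic-colouring {u} {v}) complete))

  realisation : ∃[ G ] (Connected {N} G × ChromaticNumber G f × GrundyNumber G f × AchromaticNumber G h)
  realisation = graph , connected , chromatic , grundy-number , achromatic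

-- With f = b + 3 and h = f + 1 + o, the construction with m = o + 1 has
-- 2h − f + 1 vertices and achromatic number h.
vertex-count : ∀ b o → Construction.N b (suc o) ≡ 2 * (suc (3 + b) + o) ∸ (3 + b) + 1
vertex-count b o = begin
  Construction.N b (suc o)                   ≡⟨ count b o ⟩
  (b + 2 * o + 5) + 1                        ≡⟨ cong (_+ 1) (m+n∸n≡m (b + 2 * o + 5) (3 + b)) ⟨
  (b + 2 * o + 5) + (3 + b) ∸ (3 + b) + 1    ≡⟨ cong (λ n → n ∸ (3 + b) + 1) (double b o) ⟩
  2 * (suc (3 + b) + o) ∸ (3 + b) + 1        ∎
  where
  open ≡-Reasoning
  count : ∀ b o → suc b + (1 + (1 + (suc o + suc (suc o)))) ≡ (b + 2 * o + 5) + 1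
  count = solve-∀
  double : ∀ b o → (b + 2 * o + 5) + (3 + b) ≡ 2 * (suc (3 + b) + o)
  double = solve-∀

achromatic-value : ∀ b o → Construction.h b (suc o) ≡ suc (3 + b) + o
achromatic-value = upper-end
  where
  upper-end : ∀ b o → suc (suc b) + suc (suc o) ≡ suc (3 + b) + o
  upper-end = solve-∀

lemma3 : ∀ (f g h : ℕ) → 2 < f → f ≡ g → g < h →
    ∃[ G ] (Connected {2 * h ∸ f + 1} G × ChromaticNumber G f × GrundyNumber G g × AchromaticNumber G h)
lemma3 f .f h 2<f refl f<h with m≤n⇒∃[o]m+o≡n 2<f | m≤n⇒∃[o]m+o≡n f<h
... | b , refl | o , refl =
  subst₂ Realised (vertex-count b o) (achromatic-value b o) (Construction.realisation b (suc o))
  where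
  Realised : ℕ → ℕ → Set₁
  Realised n ψ = ∃[ G ] (Connected {n} G × ChromaticNumber G (3 + b) × GrundyNumber G (3 + b) × AchromaticNumber G ψ)
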